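{- For each $i\ge 7$, the string $F_{i-2}\,Q_i$ occurs in $F_i$ exactly at positions $1$ and $f_{i-2}+1$.
   Context: Fibonacci words: $F_1=\texttt{b}$, $F_2=\texttt{a}$, $F_k=F_{k-1}F_{k-2}$ for $k\ge 3$; $f_k=|F_k|$. For $i\ge 7$, $Q_i:=F_{i-5}F_{i-6}\cdots F_3F_2$. Positions are 1-indexed; $S$ occurs at position $p$ in $T$ if $T[p\ldots p+|S|-1]=S$. -}

module Defs where

open import Data.Nat using (ℕ; zero; suc; _∸_; _≤_)
open import Data.List using (List; []; _∷_; _++_; take; drop; length)
open import Data.Product using (_×_)
open import Relation.Binary.PropositionalEquality using (_≡_)

data Letter : Set where
  a b : Letter

-- Fibonacci words, 1-indexed: F 1 = b, F 2 = a, F k = F (k-1) F (k-2).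
-- F 0 is an unused junk value (empty word).
F : ℕ → List Letter
F zero = []
F (suc zero) = b ∷ []
F (suc (suc zero)) = a ∷ []
F (suc (suc (suc k))) = F (suc (suc k)) ++ F (suc k)

f : ℕ → ℕ
f k = length (F k)

Qfrom : ℕ → List Letter
Qfrom zero = []
Qfrom (suc zero) = []
Qfrom (suc (suc zero)) = F 2
Qfrom (suc (suc (suc k))) = F (suc (suc (suc k))) ++ Qfrom (suc (suc k))

Q : ℕ → List Letter
Q i = Qfrom (i ∸ 5)

OccursAt : List Letter → List Letter → ℕ → Set
OccursAt S T p = (1 ≤ p) × (take (length S) (drop (p ∸ 1) T) ≡ S)

-- Write P n = F n F (n-1) ⋯ F 2 (this is Qfrom n).  The words F (n+1) F n and F n F (n+1) are
-- P n x y and P n y x for two distinct letters x, y, so P n occurs in F (n+3) = F (n+1) F n F (n+1)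
-- at offsets 0 and f (n+1), and the period f (n+1) this creates breaks right after P n.  By
-- induction, the prefix of length f (m+1) - 1 of F (m+1) has no period d with 0 < d < f m:
-- a period d < f (m-1) already lives in F m, d = f (m-1) runs into the break, and for d > f (m-1)
-- the periods d and f (m-1) combine into the period d - f (m-1) < f (m-2) of a prefix of F (m-1).
-- Finally F (i-2) Q i = P (i-3), and a second occurrence at offset d > 0 makes d a period of the
-- prefix of length d + |P (i-3)| of F i, which leaves only d = f (i-2).
module Submission where

open import Defs
open import Data.Nat using (ℕ; zero; suc; _+_; _∸_; _≤_; _<_; _⊓_; z≤n; s≤s; >-nonZero)
open import Data.Nat.Properties
open import Data.List using (List; []; _∷_; _++_; take; drop; length)
open import Data.List.Properties using (++-assoc; ++-identityʳ; length-++; length-take; length-drop)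
open import Data.Maybe using (Maybe; nothing; just)
open import Data.Maybe.Properties using (just-injective)
open import Data.Sum using (_⊎_; inj₁; inj₂)
open import Data.Product using (_,_)
open import Data.Empty using (⊥; ⊥-elim)
open import Function.Bundles using (_⇔_; mk⇔)
open import Relation.Nullary using (¬_)
open import Relation.Binary.Definitions using (Tri; tri<; tri≈; tri>)
open import Relation.Binary.PropositionalEquality
  using (_≡_; _≢_; refl; sym; trans; cong; subst; subst₂; module ≡-Reasoning)

-- 0-based, unlike the 1-based positions of OccursAt.
at : List Letter → ℕ → Maybe Letter
at []      _       = nothing
at (c ∷ _) zero    = just c
at (_ ∷ w) (suc j) = at w j

at-take : ∀ n w {j} → j < n → at (take n w) j ≡ at w j
at-take (suc n) []      _         = refl
at-take (suc n) (c ∷ w) {zero}  _ = refl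
at-take (suc n) (c ∷ w) {suc j} (s≤s j<n) = at-take n w j<n

at-drop : ∀ d w j → at (drop d w) j ≡ at w (d + j)
at-drop zero    w       j = refl
at-drop (suc d) []      j = refl
at-drop (suc d) (_ ∷ w) j = at-drop d w j

at-++ʳ : ∀ {T} U {V} j → T ≡ U ++ V → at T (length U + j) ≡ at V j
at-++ʳ []      j refl = refl
at-++ʳ (_ ∷ U) j refl = at-++ʳ U j refl

at-++-∷ : ∀ {T} U {c R} → T ≡ U ++ c ∷ R → at T (length U) ≡ just c
at-++-∷ []      refl = refl
at-++-∷ (_ ∷ U) refl = at-++-∷ U refl

occurs-++ : ∀ {T : List Letter} U S {R} → T ≡ U ++ S ++ R → take (length S) (drop (length U) T) ≡ S
occurs-++ []      []      refl = refl
occurs-++ []      (c ∷ S) refl = cong (c ∷_) (occurs-++ [] S refl)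
occurs-++ (_ ∷ U) S       refl = occurs-++ U S refl

occurrence-at : ∀ {S T d j} → take (length S) (drop d T) ≡ S → j < length S →
                at T (d + j) ≡ at S j
occurrence-at {S} {T} {d} {j} occ j<s = begin
  at T (d + j)                          ≡⟨ sym (at-drop d T j) ⟩
  at (drop d T) j                       ≡⟨ sym (at-take (length S) (drop d T) j<s) ⟩
  at (take (length S) (drop d T)) j     ≡⟨ cong (λ w → at w j) occ ⟩
  at S j                                ∎
  where open ≡-Reasoning

occurrence-fits : ∀ {S T : List Letter} d → 0 < length S → take (length S) (drop d T) ≡ S →
                  d + length S ≤ length T
occurrence-fits {S} {T} d 0<s occ =
  subst (_≤ length T) (+-comm (length S) d) (m≤o∸n⇒m+n≤o (length S) d≤T s≤T∸d)
  where
  s≤T∸d : length S ≤ length T ∸ d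
  s≤T∸d = m⊓n≡m⇒m≤n (begin
    length S ⊓ (length T ∸ d)              ≡⟨ cong (length S ⊓_) (sym (length-drop d T)) ⟩
    length S ⊓ length (drop d T)           ≡⟨ sym (length-take (length S) (drop d T)) ⟩
    length (take (length S) (drop d T))    ≡⟨ cong length occ ⟩
    length S                               ∎)
    where open ≡-Reasoning
  d≤T : d ≤ length T
  d≤T = <⇒≤ (m∸n≢0⇒n<m (λ T∸d≡0 → <⇒≱ 0<s (subst (length S ≤_) T∸d≡0 s≤T∸d)))

Period : List Letter → ℕ → ℕ → Set
Period T d L = ∀ j → d + j < L → at T j ≡ at T (d + j)

Period-mono : ∀ {T d L M} → M ≤ L → Period T d L → Period T d M
Period-mono M≤L per j lt = per j (<-≤-trans lt M≤L)

occurrences⇒Period : ∀ {S T d} → take (length S) T ≡ S → take (length S) (drop d T) ≡ S →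
                     Period T d (d + length S)
occurrences⇒Period {S} {T} {d} occ₀ occ j lt =
  trans (occurrence-at {T = T} {d = 0} occ₀ j<s) (sym (occurrence-at {T = T} occ j<s))
  where
  j<s : j < length S
  j<s = +-cancelˡ-< d j (length S) lt

Period-∸ : ∀ {T e d L} → e ≤ d → Period T e (e + L) → Period T d (e + L) → Period T (d ∸ e) L
Period-∸ {T} {e} {d} {L} e≤d per-e per-d j lt = begin
  at T j                     ≡⟨ per-d j (subst (_< e + L) shift (+-monoʳ-< e lt)) ⟩
  at T (d + j)               ≡⟨ cong (at T) (sym shift) ⟩
  at T (e + (d ∸ e + j))     ≡⟨ sym (per-e (d ∸ e + j) (+-monoʳ-< e lt)) ⟩
  at T (d ∸ e + j)           ∎
  where
  open ≡-Reasoning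
  shift : e + (d ∸ e + j) ≡ d + j
  shift = trans (sym (+-assoc e (d ∸ e) j)) (cong (_+ j) (m+[n∸m]≡n e≤d))

f-rec : ∀ n → f (3 + n) ≡ f (2 + n) + f (1 + n)
f-rec n = length-++ (F (2 + n))

f-pos : ∀ n → 0 < f (suc n)
f-pos zero          = s≤s z≤n
f-pos (suc zero)    = s≤s z≤n
f-pos (suc (suc n)) = subst (0 <_) (sym (f-rec n)) (≤-trans (f-pos (suc n)) (m≤m+n _ _))

3≤f : ∀ n → 3 ≤ f (4 + n)
3≤f n = subst (3 ≤_) (sym (trans (f-rec (suc n)) (cong (_+ f (2 + n)) (f-rec n))))
          (+-mono-≤ (+-mono-≤ (f-pos (suc n)) (f-pos n)) (f-pos (suc n)))

record NearCommute (n : ℕ) : Set where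
  field
    x y    : Letter
    x≢y    : x ≢ y
    Qfrom-xy : Qfrom n ++ x ∷ y ∷ [] ≡ F (suc n) ++ F n
    Qfrom-yx : Qfrom n ++ y ∷ x ∷ [] ≡ F n ++ F (suc n)

near-commute : ∀ n → NearCommute (suc n)
near-commute zero       = record { x = a ; y = b ; x≢y = λ () ; Qfrom-xy = refl ; Qfrom-yx = refl }
near-commute (suc zero) = record { x = b ; y = a ; x≢y = λ () ; Qfrom-xy = refl ; Qfrom-yx = refl }
near-commute (suc (suc n)) = record
  { x = y ; y = x ; x≢y = λ y≡x → x≢y (sym y≡x)
  ; Qfrom-xy = begin
      (F₃ ++ Q₂) ++ y ∷ x ∷ []  ≡⟨ ++-assoc F₃ Q₂ _ ⟩
      F₃ ++ (Q₂ ++ y ∷ x ∷ [])  ≡⟨ cong (F₃ ++_) Qfrom-yx ⟩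
      F₃ ++ (F₂ ++ F₃)          ≡⟨ sym (++-assoc F₃ F₂ F₃) ⟩
      (F₃ ++ F₂) ++ F₃          ∎
  ; Qfrom-yx = trans (++-assoc F₃ Q₂ _) (cong (F₃ ++_) Qfrom-xy)
  }
  where
  open ≡-Reasoning
  open NearCommute (near-commute (suc n))
  F₂ = F (2 + n)
  F₃ = F (3 + n)
  Q₂ = Qfrom (2 + n)

length-Qfrom : ∀ n → f (3 + n) ≡ 2 + length (Qfrom (suc n))
length-Qfrom n = begin
  f (3 + n)                          ≡⟨ cong length (sym Qfrom-xy) ⟩
  length (Qfrom (suc n) ++ x ∷ y ∷ []) ≡⟨ length-++ (Qfrom (suc n)) ⟩
  length (Qfrom (suc n)) + 2           ≡⟨ +-comm _ 2 ⟩
  2 + length (Qfrom (suc n))           ∎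
  where
  open ≡-Reasoning
  open NearCommute (near-commute n)

NoShortPeriod : ℕ → Set
NoShortPeriod m = ∀ {T R d L} → T ≡ F (suc m) ++ R → 0 < d → d < f m → f (suc m) ≤ suc L →
                  ¬ Period T d L

module Qfrom-in-F (n : ℕ) {T R : List Letter} (T≡ : T ≡ F (4 + n) ++ R) where
  open NearCommute (near-commute n)
  open ≡-Reasoning

  private
    P = Qfrom (suc n)

  T≡Qfrom++xy : T ≡ P ++ x ∷ y ∷ F (2 + n) ++ R
  T≡Qfrom++xy = begin
    T                                        ≡⟨ T≡ ⟩
    (F (3 + n) ++ F (2 + n)) ++ R            ≡⟨ ++-assoc (F (3 + n)) _ R ⟩
    F (3 + n) ++ F (2 + n) ++ R              ≡⟨ cong (_++ F (2 + n) ++ R) (sym Qfrom-xy) ⟩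
    (P ++ x ∷ y ∷ []) ++ F (2 + n) ++ R      ≡⟨ ++-assoc P _ _ ⟩
    P ++ x ∷ y ∷ F (2 + n) ++ R              ∎

  T≡F++Qfrom++yx : T ≡ F (2 + n) ++ P ++ y ∷ x ∷ R
  T≡F++Qfrom++yx = begin
    T                                              ≡⟨ T≡ ⟩
    ((F (2 + n) ++ F (1 + n)) ++ F (2 + n)) ++ R   ≡⟨ cong (_++ R) (++-assoc (F (2 + n)) _ _) ⟩
    (F (2 + n) ++ F (1 + n) ++ F (2 + n)) ++ R     ≡⟨ ++-assoc (F (2 + n)) _ R ⟩
    F (2 + n) ++ (F (1 + n) ++ F (2 + n)) ++ R     ≡⟨ cong (λ w → F (2 + n) ++ w ++ R) (sym Qfrom-yx) ⟩
    F (2 + n) ++ (P ++ y ∷ x ∷ []) ++ R            ≡⟨ cong (F (2 + n) ++_) (++-assoc P _ R) ⟩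
    F (2 + n) ++ P ++ y ∷ x ∷ R                    ∎

  Qfrom-occurs-at-0 : take (length P) T ≡ P
  Qfrom-occurs-at-0 = occurs-++ [] P T≡Qfrom++xy

  Qfrom-occurs-at-f : take (length P) (drop (f (2 + n)) T) ≡ P
  Qfrom-occurs-at-f = occurs-++ (F (2 + n)) P T≡F++Qfrom++yx

  period-f : Period T (f (2 + n)) (f (2 + n) + length P)
  period-f = occurrences⇒Period {T = T} Qfrom-occurs-at-0 Qfrom-occurs-at-f

  period-f-breaks : at T (length P) ≢ at T (f (2 + n) + length P)
  period-f-breaks eq = x≢y (just-injective (begin
    just x                         ≡⟨ sym (at-++-∷ P T≡Qfrom++xy) ⟩
    at T (length P)                ≡⟨ eq ⟩
    at T (f (2 + n) + length P)    ≡⟨ at-++ʳ (F (2 + n)) (length P) T≡F++Qfrom++yx ⟩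
    at (P ++ y ∷ x ∷ R) (length P) ≡⟨ at-++-∷ P refl ⟩
    just y                         ∎))

no-short-period-step : ∀ n → NoShortPeriod (2 + n) → NoShortPeriod (1 + n) → NoShortPeriod (3 + n)
no-short-period-step n no-short₂ no-short₁ {T} {R} {d} {L} T≡ 0<d d<C f₄≤1+L per =
  by-cases (<-cmp d B)
  where
  A = f (1 + n)
  B = f (2 + n)
  C = f (3 + n)
  q = length (Qfrom (suc n))

  B+q<L : B + q < L
  B+q<L = subst (_< L) (+-comm q B)
            (≤-pred (subst (_≤ suc L) (trans (f-rec (suc n)) (cong (_+ B) (length-Qfrom n))) f₄≤1+L))

  by-cases : Tri (d < B) (d ≡ B) (B < d) → ⊥
  by-cases (tri< d<B _ _) =
    no-short₂ (trans T≡ (++-assoc (F (3 + n)) (F (2 + n)) R)) 0<d d<B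
      (≤-trans (m≤m+n C B) (subst (_≤ suc L) (f-rec (suc n)) f₄≤1+L)) per
  by-cases (tri≈ _ d≡B _) =
    Qfrom-in-F.period-f-breaks n T≡ (subst (λ e → Period T e L) d≡B per q B+q<L)
  by-cases (tri> _ _ B<d) =
    no-short₁ T≡F₂++ (m<n⇒0<n∸m B<d) d∸B<A B≤1+q
      (Period-∸ {T} (<⇒≤ B<d) (Qfrom-in-F.period-f n T≡) (Period-mono {T} (<⇒≤ B+q<L) per))
    where
    T≡F₂++ : T ≡ F (2 + n) ++ F (1 + n) ++ F (2 + n) ++ R
    T≡F₂++ = trans T≡ (trans (++-assoc (F (3 + n)) _ R) (++-assoc (F (2 + n)) _ _))
    d∸B<A : d ∸ B < A
    d∸B<A = m<n+o⇒m∸n<o d B {{>-nonZero (f-pos n)}} (subst (d <_) (f-rec n) d<C)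
    B≤1+q : B ≤ suc q
    B≤1+q = ≤-pred (subst₂ _≤_ (+-comm B 1) (trans (sym (f-rec n)) (length-Qfrom n))
                     (+-monoʳ-≤ B (f-pos n)))

no-short-period : ∀ m → NoShortPeriod m
no-short-period zero                _ _         ()
no-short-period (suc zero)          _ (s≤s z≤n) (s≤s ())
no-short-period (suc (suc zero))    _ (s≤s z≤n) (s≤s ())
no-short-period (suc (suc (suc n))) =
  no-short-period-step n (no-short-period (suc (suc n))) (no-short-period (suc n))

module _ (k : ℕ) where
  private
    S = Qfrom (4 + k)
    s = length S
    T = F (7 + k)
    open Qfrom-in-F (3 + k) {T} {[]} (sym (++-identityʳ T))

    f₆≡2+s : f (6 + k) ≡ 2 + s
    f₆≡2+s = length-Qfrom (3 + k)

    f₇≡ : f (7 + k) ≡ (2 + f (5 + k)) + s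
    f₇≡ = trans (f-rec (4 + k))
            (trans (cong (_+ f (5 + k)) f₆≡2+s) (cong (2 +_) (+-comm s (f (5 + k)))))

  Qfrom-shift≡f : ∀ {d} → 0 < d → take s (drop d T) ≡ S → d ≡ f (5 + k)
  Qfrom-shift≡f {d} 0<d occ = by-cases (<-cmp d (f (5 + k)))
    where
    per : Period T d (d + s)
    per = occurrences⇒Period {T = T} Qfrom-occurs-at-0 occ

    0<s : 0 < s
    0<s = ≤-pred (≤-pred (subst (3 ≤_) f₆≡2+s (3≤f (2 + k))))

    d≤2+f₅ : d ≤ 2 + f (5 + k)
    d≤2+f₅ = +-cancelʳ-≤ s d _ (subst (d + s ≤_) f₇≡ (occurrence-fits d 0<s occ))

    -- This is where i ≥ 7 is needed: for i = 6 the offset f (i-2) + 2 occurs as well.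
    f₅+2<f₆ : 2 + f (5 + k) < f (6 + k)
    f₅+2<f₆ = subst (2 + f (5 + k) <_) (trans (+-comm _ (f (5 + k))) (sym (f-rec (3 + k))))
                (+-monoˡ-≤ (f (5 + k)) (3≤f k))

    by-cases : Tri (d < f (5 + k)) (d ≡ f (5 + k)) (f (5 + k) < d) → d ≡ f (5 + k)
    by-cases (tri< d<f₅ _ _) =
      ⊥-elim (no-short-period (5 + k) refl 0<d d<f₅
               (subst (_≤ suc (d + s)) (sym f₆≡2+s) (s≤s (+-monoˡ-≤ s 0<d))) per)
    by-cases (tri≈ _ d≡f₅ _) = d≡f₅
    by-cases (tri> _ _ f₅<d) =
      ⊥-elim (no-short-period (6 + k) (sym (++-identityʳ T)) 0<d (≤-<-trans d≤2+f₅ f₅+2<f₆)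
               (subst (_≤ suc (d + s)) (sym f₇≡) (+-monoˡ-≤ s (s≤s f₅<d))) per)

  Qfrom-occurs-only-at : ∀ p → OccursAt S T p → p ≡ 1 ⊎ p ≡ f (5 + k) + 1
  Qfrom-occurs-only-at (suc zero)    _         = inj₁ refl
  Qfrom-occurs-only-at (suc (suc d)) (_ , occ) =
    inj₂ (trans (cong suc (Qfrom-shift≡f (s≤s z≤n) occ)) (+-comm 1 _))

  Qfrom-occurs-at : ∀ p → p ≡ 1 ⊎ p ≡ f (5 + k) + 1 → OccursAt S T p
  Qfrom-occurs-at _ (inj₁ refl) = s≤s z≤n , Qfrom-occurs-at-0
  Qfrom-occurs-at _ (inj₂ refl) =
    m≤n+m 1 _ , subst (λ e → take s (drop e T) ≡ S) (sym (m+n∸n≡m (f (5 + k)) 1)) Qfrom-occurs-at-f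

lemma24 : (i : ℕ) → 7 ≤ i → (p : ℕ) →
    OccursAt (F (i ∸ 2) ++ Q i) (F i) p ⇔ (p ≡ 1 ⊎ p ≡ f (i ∸ 2) + 1)
lemma24 i 7≤i p with m≤n⇒∃[o]m+o≡n 7≤i
... | k , refl = subst (λ S → OccursAt S (F (7 + k)) p ⇔ (p ≡ 1 ⊎ p ≡ f (5 + k) + 1))
                   (sym (++-assoc (F (4 + k)) (F (3 + k)) (Qfrom (2 + k))))
                   (mk⇔ (Qfrom-occurs-only-at k p) (Qfrom-occurs-at k p))
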